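{- Let $r$ and $s$ be natural numbers and set $\alpha = \frac{(r-1)(s-1)}{rs}$. There is an effectively computable constant $C>0$, depending only on $r$ and $s$, such that for every natural number $n$ the interval $[n, n+Cn^{\alpha}]$ contains an integer $m$ which can be written as $m = A^r + B^s$ with $A$ and $B$ integers. -}

module Submission where

open import Data.Nat using (ℕ; _+_; _*_; _∸_; _^_; _≤_; _<_; suc)
open import Data.Integer using (ℤ; +_) renaming (_+_ to _+ℤ_; _^_ to _^ℤ_)
open import Data.Product using (Σ; _×_; _,_)
open import Relation.Binary.PropositionalEquality using (_≡_)

open import Data.Nat using (zero; z≤n; s≤s; NonZero; >-nonZero⁻¹; _<?_)
open import Data.Nat.Properties
open import Data.Nat.Solver using (module +-*-Solver)
import Data.Integer as ℤ
import Data.Integer.Properties as ℤ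
open import Relation.Binary.PropositionalEquality
  using (refl; sym; trans; cong; cong₂; subst; module ≡-Reasoning)
open import Relation.Nullary using (yes; no)

-- Write r = k + 1 and s = j + 1.  Consecutive (k+1)-th powers
-- satisfy (a+1)^(k+1) - a^(k+1) ≤ c_k a^k with c_k = 2^(k+1) - 1, so every
-- n lies less than c_k a^k above the largest r-th power a^r ≤ n; writing
-- n = a^r + d this gives d^r ≤ c_k^r n^k.  In the same way d lies at most
-- c_j a'^j below the least s-th power b^s ≥ d (where b = a' + 1), so
-- b^s = d + e with e^s ≤ c_j^s d^j.  Then m = a^r + b^s = n + e, and
-- composing the two estimates yields e^(rs) ≤ (c_j c_k)^(rs) n^(kj), which
-- is the statement with C = c_j c_k (the paper's n^α bound raised to rs).

^-distribʳ-* : ∀ x y n → (x * y) ^ n ≡ x ^ n * y ^ n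
^-distribʳ-* x y zero = refl
^-distribʳ-* x y (suc n) = begin
    x * y * (x * y) ^ n     ≡⟨ cong (x * y *_) (^-distribʳ-* x y n) ⟩
    x * y * (x ^ n * y ^ n) ≡⟨ solve 4 (λ x y p q → (x :* y) :* (p :* q) := (x :* p) :* (y :* q))
                                 refl x y (x ^ n) (y ^ n) ⟩
    x * x ^ n * (y * y ^ n) ∎
  where
  open ≡-Reasoning
  open +-*-Solver

^-*-assoc′ : ∀ x a b → (x ^ a) ^ b ≡ x ^ (b * a)
^-*-assoc′ x a b = trans (^-*-assoc x a b) (cong (x ^_) (*-comm a b))

-- The constant c_k = 2^(k+1) - 1, defined by c_0 = 1, c_(k+1) = 2 c_k + 1.
gapConst : ℕ → ℕ
gapConst zero = 1
gapConst (suc k) = suc (2 * gapConst k)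

-- c_k ≥ 1; needed because the final constant must be positive and because
-- raising c_k to a larger exponent must not decrease it.
gapConst-nonZero : ∀ k → NonZero (gapConst k)
gapConst-nonZero zero = _
gapConst-nonZero (suc k) = _

-- Gap between consecutive powers: (a+1)^(k+1) ≤ a^(k+1) + c_k a^k for a ≥ 1.
-- Induction on k, multiplying the previous bound by a + 1 and using a^k ≤ a^(k+1).
powerGap : ∀ k a → 1 ≤ a → suc a ^ suc k ≤ a ^ suc k + gapConst k * a ^ k
powerGap zero a _ = ≤-reflexive (+-comm 1 (a * 1))
powerGap (suc k) a 1≤a = begin
    suc a * suc a ^ suc k
  ≤⟨ *-monoʳ-≤ (suc a) (powerGap k a 1≤a) ⟩
    suc a * (a * P + c * P)
  ≡⟨ solve 3 (λ a P c → (con 1 :+ a) :* (a :* P :+ c :* P)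
                  := a :* (a :* P) :+ (con 1 :+ c) :* (a :* P) :+ c :* P) refl a P c ⟩
    a * (a * P) + suc c * (a * P) + c * P
  ≤⟨ +-monoʳ-≤ (a * (a * P) + suc c * (a * P)) (*-monoʳ-≤ c P≤aP) ⟩
    a * (a * P) + suc c * (a * P) + c * (a * P)
  ≡⟨ solve 3 (λ a P c → a :* (a :* P) :+ (con 1 :+ c) :* (a :* P) :+ c :* (a :* P)
                  := a :* (a :* P) :+ (con 1 :+ con 2 :* c) :* (a :* P)) refl a P c ⟩
    a * (a * P) + gapConst (suc k) * (a * P)
  ∎
  where
  open ≤-Reasoning
  open +-*-Solver
  P = a ^ k
  c = gapConst k
  P≤aP : P ≤ a * P
  P≤aP = subst (_≤ a * P) (*-identityˡ P) (*-monoˡ-≤ P 1≤a)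

integerRoot : ∀ k n → Σ ℕ λ a → (a ^ suc k ≤ n) × (n < suc a ^ suc k)
integerRoot k zero = 0 , z≤n , m^n>0 1 (suc k)
integerRoot k (suc n) with integerRoot k n
... | a , a^r≤n , n<[1+a]^r with suc n <? suc a ^ suc k
...   | yes n+1<[1+a]^r = a , m≤n⇒m≤1+n a^r≤n , n+1<[1+a]^r
...   | no n+1≮[1+a]^r = suc a , ≤-reflexive (sym n+1≡[1+a]^r) ,
          ≤-<-trans (≤-reflexive n+1≡[1+a]^r) (^-monoˡ-< (suc k) (n<1+n (suc a)))
  where
  n+1≡[1+a]^r : suc n ≡ suc a ^ suc k
  n+1≡[1+a]^r = ≤-antisym n<[1+a]^r (≮⇒≥ n+1≮[1+a]^r)

excessBound : ∀ j C e a d → e ≤ C * a ^ j → a ^ suc j ≤ d → e ^ suc j ≤ C ^ suc j * d ^ j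
excessBound j C e a d e≤Ca^j a^r≤d = begin
    e ^ suc j                   ≤⟨ ^-monoˡ-≤ (suc j) e≤Ca^j ⟩
    (C * a ^ j) ^ suc j         ≡⟨ ^-distribʳ-* C (a ^ j) (suc j) ⟩
    C ^ suc j * (a ^ j) ^ suc j ≡⟨ cong (C ^ suc j *_) (trans (^-*-assoc′ a j (suc j)) (sym (^-*-assoc a (suc j) j))) ⟩
    C ^ suc j * (a ^ suc j) ^ j ≤⟨ *-monoʳ-≤ (C ^ suc j) (^-monoˡ-≤ j a^r≤d) ⟩
    C ^ suc j * d ^ j           ∎
  where open ≤-Reasoning

powerBelow : ∀ k n → Σ ℕ λ a → Σ ℕ λ d →
  (n ≡ a ^ suc k + d) × (d ^ suc k ≤ gapConst k ^ suc k * n ^ k)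
powerBelow k n with integerRoot k n
... | zero , _ , n<1 = 0 , 0 , n<1⇒n≡0 (subst (n <_) (^-zeroˡ (suc k)) n<1) , z≤n
... | suc a , a^r≤n , n<[1+a]^r = suc a , d , sym (m+[n∸m]≡n a^r≤n) ,
        excessBound k (gapConst k) d (suc a) n d≤gap a^r≤n
  where
  d = n ∸ suc a ^ suc k
  d≤gap : d ≤ gapConst k * suc a ^ k
  d≤gap = m≤n+o⇒m∸n≤o n (suc a ^ suc k)
            (≤-trans (<⇒≤ n<[1+a]^r) (powerGap k (suc a) (s≤s z≤n)))

powerAbove : ∀ j d → Σ ℕ λ b → Σ ℕ λ e →
  (b ^ suc j ≡ d + e) × (e ^ suc j ≤ gapConst j ^ suc j * d ^ j)
powerAbove j d with integerRoot j d
... | zero , _ , d<1 = 0 , 0 , sym (trans (+-identityʳ d) (n<1⇒n≡0 (subst (d <_) (^-zeroˡ (suc j)) d<1))) , z≤n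
... | suc a , a^s≤d , d<[1+a]^s = suc (suc a) , e , sym (m+[n∸m]≡n (<⇒≤ d<[1+a]^s)) ,
        excessBound j (gapConst j) e (suc a) d e≤gap a^s≤d
  where
  e = suc (suc a) ^ suc j ∸ d
  e≤gap : e ≤ gapConst j * suc a ^ j
  e≤gap = ≤-trans (∸-monoʳ-≤ (suc (suc a) ^ suc j) a^s≤d)
            (m≤n+o⇒m∸n≤o (suc (suc a) ^ suc j) (suc a ^ suc j) (powerGap j (suc a) (s≤s z≤n)))

composeBounds : ∀ r s j k P Q .{{_ : NonZero Q}} {e d n} → j ≤ s →
  e ^ s ≤ P ^ s * d ^ j → d ^ r ≤ Q ^ r * n ^ k →
  e ^ (r * s) ≤ (P * Q) ^ (r * s) * n ^ (k * j)
composeBounds r s j k P Q {e} {d} {n} j≤s e^s≤ d^r≤ = begin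
    e ^ (r * s)                         ≡⟨ sym (^-*-assoc′ e s r) ⟩
    (e ^ s) ^ r                         ≤⟨ ^-monoˡ-≤ r e^s≤ ⟩
    (P ^ s * d ^ j) ^ r                 ≡⟨ ^-distribʳ-* (P ^ s) (d ^ j) r ⟩
    (P ^ s) ^ r * (d ^ j) ^ r           ≡⟨ cong₂ _*_ (^-*-assoc′ P s r)
                                             (trans (^-*-assoc′ d j r) (sym (^-*-assoc d r j))) ⟩
    P ^ (r * s) * (d ^ r) ^ j           ≤⟨ *-monoʳ-≤ (P ^ (r * s)) (^-monoˡ-≤ j d^r≤) ⟩
    P ^ (r * s) * (Q ^ r * n ^ k) ^ j   ≡⟨ cong (P ^ (r * s) *_) (trans (^-distribʳ-* (Q ^ r) (n ^ k) j)
                                             (cong₂ _*_ (^-*-assoc Q r j) (^-*-assoc n k j))) ⟩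
    P ^ (r * s) * (Q ^ (r * j) * n ^ (k * j))
      ≤⟨ *-monoʳ-≤ (P ^ (r * s)) (*-monoˡ-≤ (n ^ (k * j)) (^-monoʳ-≤ Q (*-monoʳ-≤ r j≤s))) ⟩
    P ^ (r * s) * (Q ^ (r * s) * n ^ (k * j))
      ≡⟨ trans (sym (*-assoc (P ^ (r * s)) _ _)) (cong (_* n ^ (k * j)) (sym (^-distribʳ-* P Q (r * s)))) ⟩
    (P * Q) ^ (r * s) * n ^ (k * j)     ∎
  where open ≤-Reasoning

-- Approximate n from below by a^(k+1), then the remainder d from above by b^(j+1).
sumOfPowersNear : ∀ k j n → Σ ℕ λ a → Σ ℕ λ b → Σ ℕ λ e →
  (a ^ suc k + b ^ suc j ≡ n + e) ×
  (e ^ (suc k * suc j) ≤ (gapConst j * gapConst k) ^ (suc k * suc j) * n ^ (k * j))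
sumOfPowersNear k j n with powerBelow k n
... | a , d , n≡a^r+d , d^r≤ with powerAbove j d
... | b , e , b^s≡d+e , e^s≤ = a , b , e , sum≡n+e ,
        composeBounds (suc k) (suc j) j k (gapConst j) (gapConst k) {{gapConst-nonZero k}} {e} {d} {n}
          (n≤1+n j) e^s≤ d^r≤
  where
  open ≡-Reasoning
  sum≡n+e : a ^ suc k + b ^ suc j ≡ n + e
  sum≡n+e = begin
    a ^ suc k + b ^ suc j   ≡⟨ cong (λ t → a ^ suc k + t) b^s≡d+e ⟩
    a ^ suc k + (d + e)     ≡⟨ sym (+-assoc (a ^ suc k) d e) ⟩
    a ^ suc k + d + e       ≡⟨ cong (_+ e) (sym n≡a^r+d) ⟩
    n + e                   ∎

pos-^-+-^ : ∀ x r y s → + (x ^ r + y ^ s) ≡ (+ x) ^ℤ r +ℤ (+ y) ^ℤ s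
pos-^-+-^ x r y s = trans (ℤ.pos-+ (x ^ r) (y ^ s)) (cong₂ _+ℤ_ (pos-^ x r) (pos-^ y s))
  where
  pos-^ : ∀ x n → + (x ^ n) ≡ (+ x) ^ℤ n
  pos-^ x zero = refl
  pos-^ x (suc n) = trans (ℤ.pos-* x (x ^ n)) (cong (+ x ℤ.*_) (pos-^ x n))

theorem1p1 : (r s : ℕ) → 1 ≤ r → 1 ≤ s →
    Σ ℕ λ C → (0 < C) ×
      ((n : ℕ) → Σ ℕ λ m → (n ≤ m) ×
        (((m ∸ n) ^ (r * s) ≤ (C ^ (r * s)) * (n ^ ((r ∸ 1) * (s ∸ 1)))) ×
         (Σ ℤ λ A → Σ ℤ λ B → (+ m) ≡ (A ^ℤ r) +ℤ (B ^ℤ s))))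
theorem1p1 (suc k) (suc j) _ _ = C , C>0 , nearby
  where
  C = gapConst j * gapConst k
  C>0 : 0 < C
  C>0 = >-nonZero⁻¹ C {{m*n≢0 (gapConst j) (gapConst k) {{gapConst-nonZero j}} {{gapConst-nonZero k}}}}
  nearby : (n : ℕ) → Σ ℕ λ m → (n ≤ m) ×
    ((m ∸ n) ^ (suc k * suc j) ≤ C ^ (suc k * suc j) * n ^ (k * j)) ×
    (Σ ℤ λ A → Σ ℤ λ B → + m ≡ A ^ℤ suc k +ℤ B ^ℤ suc j)
  nearby n with sumOfPowersNear k j n
  ... | a , b , e , sum≡n+e , excess = n + e , m≤m+n n e ,
          subst (λ t → t ^ (suc k * suc j) ≤ _) (sym (m+n∸m≡n n e)) excess ,
          + a , + b , trans (cong +_ (sym sum≡n+e)) (pos-^-+-^ a (suc k) b (suc j))
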